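{- Let $m\ge 1$ and let $G$ be a complete bipartite graph with bipartition $\{A,B\}$, $|A|=2m$, $|B|=2m+1$. Then for every colouring of the edges of $G$ with the two colours red and blue, one of the following holds: (1) there is a monochromatic connected matching of size $m+1$; (2) there are partitions $\{X,Y\}$ of $A$ and $\{Z,W\}$ of $B$ (where one of $Z,W$ may be empty) such that $|X|=|Y|=m$, all edges in $[X,Z]$ and $[Y,W]$ are red, and all edges in $[X,W]$ and $[Y,Z]$ are blue.
   Context: For disjoint vertex sets $P,Q$, $[P,Q]$ denotes the set of edges with one end in $P$ and the other in $Q$. For a colour $c$, a $c$-coloured component is a connected component of the graph formed by the edges of colour $c$. A monochromatic connected matching of size $t$ is a matching of $t$ edges, all of the same colour $c$, contained in a single $c$-coloured component. -}

module Defs where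

open import Data.Nat using (ℕ; suc; _+_; _*_)
open import Data.Fin using (Fin)
open import Data.Sum using (_⊎_; inj₁; inj₂)
open import Data.Product using (_×_; Σ-syntax; ∃-syntax)
open import Data.Bool using (Bool; true; false)
open import Data.Fin.Subset using (Subset; _∈_; _∉_; ∣_∣; ∁)
open import Function.Definitions using (Injective)
open import Relation.Binary.PropositionalEquality using (_≡_)

data Colour : Set where
  red blue : Colour

Colouring : ℕ → ℕ → Set
Colouring a b = Fin a → Fin b → Colour

Vertex : ℕ → ℕ → Set
Vertex a b = Fin a ⊎ Fin b

data Adj {a b : ℕ} (χ : Colouring a b) (c : Colour) : Vertex a b → Vertex a b → Set where
  lr : ∀ x y → χ x y ≡ c → Adj χ c (inj₁ x) (inj₂ y)
  rl : ∀ x y → χ x y ≡ c → Adj χ c (inj₂ y) (inj₁ x)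

data Connected {a b : ℕ} (χ : Colouring a b) (c : Colour) : Vertex a b → Vertex a b → Set where
  here : ∀ {u} → Connected χ c u u
  step : ∀ {u v w} → Adj χ c u v → Connected χ c v w → Connected χ c u w

record MonoConnMatching {a b : ℕ} (χ : Colouring a b) (t : ℕ) : Set where
  field
    colour : Colour
    L      : Fin t → Fin a
    R      : Fin t → Fin b
    L-inj  : Injective _≡_ _≡_ L
    R-inj  : Injective _≡_ _≡_ R
    mono   : ∀ i → χ (L i) (R i) ≡ colour
    conn   : ∀ i j → Connected χ colour (inj₁ (L i)) (inj₁ (L j))

-- outcome (2): X = S, Y = ∁ S (partition of A); Z = T, W = ∁ T (partition of B)
Structured : (m : ℕ) → Colouring (2 * m) (suc (2 * m)) → Set
Structured m χ =
  ∃[ X ] ∃[ Z ]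
    (∣ X ∣ ≡ m) × (∣ ∁ X ∣ ≡ m)
    × (∀ x y → x ∈ X → y ∈ Z → χ x y ≡ red)
    × (∀ x y → x ∈ ∁ X → y ∈ ∁ Z → χ x y ≡ red)
    × (∀ x y → x ∈ X → y ∈ ∁ Z → χ x y ≡ blue)
    × (∀ x y → x ∈ ∁ X → y ∈ Z → χ x y ≡ blue)

-- Call a vertex of A red-heavy if it has at least m + 1 red neighbours in B,
-- and let H be the set of red-heavy vertices; since |B| = 2m + 1, every vertex
-- outside H is blue-heavy. Two vertices heavy in the same colour have a common
-- neighbour of that colour, so the heavy vertices of one colour lie in one
-- component, and m + 1 of them can be matched greedily into their neighbourhoods.
-- Otherwise |H| = |A ∖ H| = m. A colour c shared by some column b between a
-- vertex of H and a vertex outside it still gives a matching: the vertex that is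
-- not c-heavy is matched to b, and m c-heavy vertices are matched greedily
-- avoiding b. If no such column exists, every column is constant on H and takes
-- the opposite colour on A ∖ H, which is outcome (2).
module Submission where

open import Defs
open import Data.Bool using (true; false)
open import Data.Bool.Properties using (T-≡)
open import Data.Fin using (Fin; zero; suc)
open import Data.Fin.Properties using (any?)
open import Data.Fin.Subset
open import Data.Fin.Subset.Properties
open import Data.Nat using (ℕ; zero; suc; _+_; _*_; _∸_; _≤_; _<_; _≥_; _≤?_; z<s; s≤s)
open import Data.Nat.Properties
open import Data.Product using (_×_; _,_; ∃; ∃-syntax)
open import Data.Sum using (_⊎_; inj₁; inj₂)
open import Data.Vec using ([]; _∷_; tabulate)
import Data.Vec.Functional as Vector
open import Data.Vec.Properties using (lookup∘tabulate; []=⇒lookup; lookup⇒[]=)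
open import Function using (_∘_)
open import Function.Bundles using (Equivalence)
open import Function.Definitions using (Injective)
open import Level using (Level)
open import Relation.Binary.Definitions using (DecidableEquality)
open import Relation.Binary.PropositionalEquality
open import Relation.Nullary using (Dec; yes; no; ¬_; ¬?; contradiction)
open import Relation.Nullary.Decidable using (_×-dec_; isYes; fromWitness; toWitness)
open import Relation.Unary using (Pred; Decidable)

private
  variable
    ℓ : Level
    n k : ℕ
    A : Set
    c : Colour

module _ {P : Pred (Fin n) ℓ} (P? : Decidable P) where

  satisfying : Subset n
  satisfying = tabulate (isYes ∘ P?)

  ∈satisfying⁺ : ∀ {x} → P x → x ∈ satisfying
  ∈satisfying⁺ {x} px =
    lookup⇒[]= x satisfying (trans (lookup∘tabulate _ x) (Equivalence.to T-≡ (fromWitness {a? = P? x} px)))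

  ∈satisfying⁻ : ∀ {x} → x ∈ satisfying → P x
  ∈satisfying⁻ {x} x∈ =
    toWitness {a? = P? x} (Equivalence.from T-≡ (trans (sym (lookup∘tabulate _ x)) ([]=⇒lookup x∈)))

∣p∪q∣≤∣p∣+∣q∣ : (p q : Subset n) → ∣ p ∪ q ∣ ≤ ∣ p ∣ + ∣ q ∣
∣p∪q∣≤∣p∣+∣q∣ []            []            = ≤-refl
∣p∪q∣≤∣p∣+∣q∣ (true ∷ p)    (true ∷ q)    = s≤s (≤-trans (∣p∪q∣≤∣p∣+∣q∣ p q) (+-monoʳ-≤ ∣ p ∣ (n≤1+n _)))
∣p∪q∣≤∣p∣+∣q∣ (true ∷ p)    (false ∷ q)   = s≤s (∣p∪q∣≤∣p∣+∣q∣ p q)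
∣p∪q∣≤∣p∣+∣q∣ (false ∷ p)   (true ∷ q)    = ≤-trans (s≤s (∣p∪q∣≤∣p∣+∣q∣ p q)) (≤-reflexive (sym (+-suc ∣ p ∣ ∣ q ∣)))
∣p∪q∣≤∣p∣+∣q∣ (false ∷ p)   (false ∷ q)   = ∣p∪q∣≤∣p∣+∣q∣ p q

∣p∣+∣∁p∣≡n : (p : Subset n) → ∣ p ∣ + ∣ ∁ p ∣ ≡ n
∣p∣+∣∁p∣≡n p = trans (cong (∣ p ∣ +_) (∣∁p∣≡n∸∣p∣ p)) (m+[n∸m]≡n (∣p∣≤n p))

∣q∣<∣p∣⇒∃∈p∉q : (p q : Subset n) → ∣ q ∣ < ∣ p ∣ → ∃ λ x → x ∈ p × x ∉ q
∣q∣<∣p∣⇒∃∈p∉q p q q<p with any? (λ x → (x ∈? p) ×-dec ¬? (x ∈? q))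
... | yes witness = witness
... | no none     = contradiction (p⊆q⇒∣p∣≤∣q∣ p⊆q) (<⇒≱ q<p)
  where
  p⊆q : p ⊆ q
  p⊆q {x} x∈p with x ∈? q
  ... | yes x∈q = x∈q
  ... | no  x∉q = contradiction (x , x∈p , x∉q) none

0<∣p∣⇒Nonempty : (p : Subset n) → 0 < ∣ p ∣ → Nonempty p
0<∣p∣⇒Nonempty {n} p pos with nonempty? p
... | yes ne    = ne
... | no  empty = contradiction (trans (cong ∣_∣ (Empty-unique empty)) (∣⊥∣≡0 n)) (>⇒≢ pos)

n<∣p∣+∣q∣⇒Nonempty[p∩q] : (p q : Subset n) → n < ∣ p ∣ + ∣ q ∣ → Nonempty (p ∩ q)
n<∣p∣+∣q∣⇒Nonempty[p∩q] {n} p q n<p+q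
  with ∣q∣<∣p∣⇒∃∈p∉q p (∁ q) ∁q<p
  where
  ∁q<p : ∣ ∁ q ∣ < ∣ p ∣
  ∁q<p = begin-strict
    ∣ ∁ q ∣           ≡⟨ ∣∁p∣≡n∸∣p∣ q ⟩
    n ∸ ∣ q ∣         <⟨ n<1+n _ ⟩
    suc (n ∸ ∣ q ∣)   ≡⟨ sym (+-∸-assoc 1 (∣p∣≤n q)) ⟩
    suc n ∸ ∣ q ∣     ≤⟨ m≤n+o⇒m∸n≤o (suc n) ∣ q ∣ (≤-trans n<p+q (≤-reflexive (+-comm ∣ p ∣ ∣ q ∣))) ⟩
    ∣ p ∣             ∎
    where open ≤-Reasoning
... | x , x∈p , x∉∁q = x , x∈p∩q⁺ (x∈p , x∉∁p⇒x∈p x∉∁q)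

injective-∷ : ∀ {x : A} {f : Fin k → A} → Injective _≡_ _≡_ f → (∀ i → f i ≢ x)
  → Injective _≡_ _≡_ (x Vector.∷ f)
injective-∷ f-inj fresh {zero}  {zero}  _  = refl
injective-∷ f-inj fresh {zero}  {suc j} eq = contradiction (sym eq) (fresh j)
injective-∷ f-inj fresh {suc i} {zero}  eq = contradiction eq (fresh i)
injective-∷ f-inj fresh {suc i} {suc j} eq = cong suc (f-inj eq)

record DistinctRepresentatives (N : Fin k → Subset n) (F : Subset n) : Set where
  field
    rep     : Fin k → Fin n
    rep-inj : Injective _≡_ _≡_ rep
    rep∈    : ∀ i → rep i ∈ N i
    rep∉    : ∀ i → rep i ∉ F

distinctRepresentatives : ∀ k (N : Fin k → Subset n) (F : Subset n)
  → (∀ i → ∣ F ∣ + k ≤ ∣ N i ∣) → DistinctRepresentatives N F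
distinctRepresentatives zero N F _ = record
  { rep = Vector.[] ; rep-inj = λ { {()} } ; rep∈ = λ () ; rep∉ = λ () }
distinctRepresentatives (suc k) N F large
  with ∣q∣<∣p∣⇒∃∈p∉q (N zero) F (<-≤-trans (m<m+n ∣ F ∣ z<s) (large zero))
... | r , r∈N₀ , r∉F = record
  { rep     = r Vector.∷ rep
  ; rep-inj = injective-∷ rep-inj λ i eq → rep∉ i (subst (_∈ F ∪ ⁅ r ⁆) (sym eq) (q⊆p∪q F ⁅ r ⁆ (x∈⁅x⁆ r)))
  ; rep∈    = λ { zero → r∈N₀ ; (suc i) → rep∈ i }
  ; rep∉    = λ { zero → r∉F ; (suc i) → rep∉ i ∘ p⊆p∪q ⁅ r ⁆ }
  }
  where
  still-large : ∀ i → ∣ F ∪ ⁅ r ⁆ ∣ + k ≤ ∣ N (suc i) ∣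
  still-large i = begin
    ∣ F ∪ ⁅ r ⁆ ∣ + k        ≤⟨ +-monoˡ-≤ k (∣p∪q∣≤∣p∣+∣q∣ F ⁅ r ⁆) ⟩
    ∣ F ∣ + ∣ ⁅ r ⁆ ∣ + k    ≡⟨ cong (λ s → ∣ F ∣ + s + k) (∣⁅x⁆∣≡1 r) ⟩
    ∣ F ∣ + 1 + k            ≡⟨ +-assoc ∣ F ∣ 1 k ⟩
    ∣ F ∣ + suc k            ≤⟨ large (suc i) ⟩
    ∣ N (suc i) ∣            ∎
    where open ≤-Reasoning
  open DistinctRepresentatives (distinctRepresentatives k (N ∘ suc) (F ∪ ⁅ r ⁆) still-large)

_≟ᶜ_ : DecidableEquality Colour
red  ≟ᶜ red  = yes refl
red  ≟ᶜ blue = no λ ()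
blue ≟ᶜ red  = no λ ()
blue ≟ᶜ blue = yes refl

two-colours : ∀ {c d e : Colour} → c ≢ e → d ≢ e → c ≡ d
two-colours {red}  {red}  {_}    c≢e d≢e = refl
two-colours {blue} {blue} {_}    c≢e d≢e = refl
two-colours {red}  {blue} {red}  c≢e d≢e = contradiction refl c≢e
two-colours {red}  {blue} {blue} c≢e d≢e = contradiction refl d≢e
two-colours {blue} {red}  {red}  c≢e d≢e = contradiction refl d≢e
two-colours {blue} {red}  {blue} c≢e d≢e = contradiction refl c≢e

opaque
  neighbourhood : ∀ {a b} → Colouring a b → Colour → Fin a → Subset b
  neighbourhood χ c x = satisfying (λ y → χ x y ≟ᶜ c)

  ∈neighbourhood⁺ : ∀ {a b} {χ : Colouring a b} {c x y} → χ x y ≡ c → y ∈ neighbourhood χ c x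
  ∈neighbourhood⁺ {χ = χ} {c} {x} = ∈satisfying⁺ (λ y → χ x y ≟ᶜ c)

  ∈neighbourhood⁻ : ∀ {a b} {χ : Colouring a b} {c x y} → y ∈ neighbourhood χ c x → χ x y ≡ c
  ∈neighbourhood⁻ {χ = χ} {c} {x} = ∈satisfying⁻ (λ y → χ x y ≟ᶜ c)

module _ {a b} {χ : Colouring a b} {c : Colour} where

  Adj-sym : ∀ {u v} → Adj χ c u v → Adj χ c v u
  Adj-sym (lr x y eq) = rl x y eq
  Adj-sym (rl x y eq) = lr x y eq

  Connected-trans : ∀ {u v w} → Connected χ c u v → Connected χ c v w → Connected χ c u w
  Connected-trans here         q = q
  Connected-trans (step uv vw) q = step uv (Connected-trans vw q)

  Connected-sym : ∀ {u v} → Connected χ c u v → Connected χ c v u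
  Connected-sym here         = here
  Connected-sym (step uv vw) = Connected-trans (Connected-sym vw) (step (Adj-sym uv) here)

  commonNeighbour⇒Connected : ∀ {x x′ y} → χ x y ≡ c → χ x′ y ≡ c → Connected χ c (inj₁ x) (inj₁ x′)
  commonNeighbour⇒Connected xy x′y = step (lr _ _ xy) (step (rl _ _ x′y) here)

a≤m∧b≤m∧a+b≡m+m⇒a≡m : ∀ {a b m} → a ≤ m → b ≤ m → a + b ≡ m + m → a ≡ m
a≤m∧b≤m∧a+b≡m+m⇒a≡m {a} {b} {m} a≤m b≤m a+b≡m+m with m ≤? a
... | yes m≤a = ≤-antisym a≤m m≤a
... | no  m≰a = contradiction a+b≡m+m (<⇒≢ (+-mono-<-≤ (≰⇒> m≰a) b≤m))

module Bipartite (m : ℕ) (χ : Colouring (2 * m) (suc (2 * m))) where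

  2m≡m+m : 2 * m ≡ m + m
  2m≡m+m = cong (m +_) (+-identityʳ m)

  1+2m≡m+1+m : suc (2 * m) ≡ m + suc m
  1+2m≡m+1+m = trans (cong suc 2m≡m+m) (sym (+-suc m m))

  Heavy : Colour → Fin (2 * m) → Set
  Heavy c x = suc m ≤ ∣ neighbourhood χ c x ∣

  HeavySet : Colour → Subset (2 * m) → Set
  HeavySet c S = ∀ {x} → x ∈ S → Heavy c x

  heavy⇒commonNeighbour : ∀ {x x′} → Heavy c x → Heavy c x′ → ∃ λ y → χ x y ≡ c × χ x′ y ≡ c
  heavy⇒commonNeighbour {c} {x} {x′} heavy heavy′
    with n<∣p∣+∣q∣⇒Nonempty[p∩q] N N′ N+N′>1+2m
    where
    N = neighbourhood χ c x
    N′ = neighbourhood χ c x′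
    N+N′>1+2m : suc (2 * m) < ∣ N ∣ + ∣ N′ ∣
    N+N′>1+2m = <-≤-trans (s≤s (≤-reflexive 1+2m≡m+1+m)) (+-mono-≤ heavy heavy′)
  ... | y , y∈N∩N′ with x∈p∩q⁻ (neighbourhood χ c x) (neighbourhood χ c x′) y∈N∩N′
  ...   | y∈N , y∈N′ = y , ∈neighbourhood⁻ y∈N , ∈neighbourhood⁻ y∈N′

  heavy⇒Connected : ∀ {x x′} → Heavy c x → Heavy c x′ → Connected χ c (inj₁ x) (inj₁ x′)
  heavy⇒Connected heavy heavy′ with heavy⇒commonNeighbour heavy heavy′
  ... | _ , xy , x′y = commonNeighbour⇒Connected xy x′y

  ¬heavy-red⇒heavy-blue : ∀ {x} → ¬ Heavy red x → Heavy blue x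
  ¬heavy-red⇒heavy-blue {x} light = begin
    suc m                             ≡⟨ sym (m+n∸m≡n m (suc m)) ⟩
    m + suc m ∸ m                     ≡⟨ cong (_∸ m) (sym 1+2m≡m+1+m) ⟩
    suc (2 * m) ∸ m                   ≤⟨ ∸-monoʳ-≤ (suc (2 * m)) (≤-pred (≰⇒> light)) ⟩
    suc (2 * m) ∸ ∣ Red ∣             ≡⟨ sym (∣∁p∣≡n∸∣p∣ Red) ⟩
    ∣ ∁ Red ∣                         ≤⟨ p⊆q⇒∣p∣≤∣q∣ ∁Red⊆Blue ⟩
    ∣ neighbourhood χ blue x ∣        ∎
    where
    open ≤-Reasoning
    Red = neighbourhood χ red x
    ∁Red⊆Blue : ∁ Red ⊆ neighbourhood χ blue x
    ∁Red⊆Blue y∈ = ∈neighbourhood⁺ (two-colours (x∈∁p⇒x∉p y∈ ∘ ∈neighbourhood⁺) λ ())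

  H : Subset (2 * m)
  H = satisfying (λ x → suc m ≤? ∣ neighbourhood χ red x ∣)

  H-heavy : HeavySet red H
  H-heavy = ∈satisfying⁻ _

  ∁H-heavy : HeavySet blue (∁ H)
  ∁H-heavy x∈∁H = ¬heavy-red⇒heavy-blue (x∈∁p⇒x∉p x∈∁H ∘ ∈satisfying⁺ _)

  Halves : Subset (2 * m) → Set
  Halves S = ∣ S ∣ ≡ m × ∣ ∁ S ∣ ≡ m

  halves : (S : Subset (2 * m)) → ∣ S ∣ ≤ m → ∣ ∁ S ∣ ≤ m → Halves S
  halves S S≤m ∁S≤m =
    a≤m∧b≤m∧a+b≡m+m⇒a≡m S≤m ∁S≤m sum , a≤m∧b≤m∧a+b≡m+m⇒a≡m ∁S≤m S≤m (trans (+-comm ∣ ∁ S ∣ ∣ S ∣) sum)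
    where
    sum : ∣ S ∣ + ∣ ∁ S ∣ ≡ m + m
    sum = trans (∣p∣+∣∁p∣≡n S) 2m≡m+m

  record Matching (c : Colour) (S : Subset (2 * m)) (F : Subset (suc (2 * m))) (k : ℕ) : Set where
    field
      L     : Fin k → Fin (2 * m)
      R     : Fin k → Fin (suc (2 * m))
      L-inj : Injective _≡_ _≡_ L
      R-inj : Injective _≡_ _≡_ R
      L∈S   : ∀ i → L i ∈ S
      R∉F   : ∀ i → R i ∉ F
      mono  : ∀ i → χ (L i) (R i) ≡ c

  heavyMatching : ∀ {S F} → HeavySet c S → k ≤ ∣ S ∣ → ∣ F ∣ + k ≤ suc m → Matching c S F k
  heavyMatching {c} {k} {S} {F} heavy k≤S F+k≤1+m = record
    { L = rep Left ; R = rep Right ; L-inj = rep-inj Left ; R-inj = rep-inj Right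
    ; L∈S = rep∈ Left ; R∉F = rep∉ Right ; mono = ∈neighbourhood⁻ ∘ rep∈ Right }
    where
    open DistinctRepresentatives
    Left = distinctRepresentatives k (λ _ → S) ⊥ λ _ → subst (λ z → z + k ≤ ∣ S ∣) (sym (∣⊥∣≡0 (2 * m))) k≤S
    Right = distinctRepresentatives k (λ i → neighbourhood χ c (rep Left i)) F
              λ i → ≤-trans F+k≤1+m (heavy (rep∈ Left i))

  largeHeavySet⇒matching : ∀ {S} → HeavySet c S → suc m ≤ ∣ S ∣ → MonoConnMatching χ (suc m)
  largeHeavySet⇒matching {c} {S} heavy 1+m≤S = record
    { colour = c ; L = L ; R = R ; L-inj = L-inj ; R-inj = R-inj ; mono = mono
    ; conn = λ i j → heavy⇒Connected (heavy (L∈S i)) (heavy (L∈S j)) }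
    where
    open Matching (heavyMatching {F = ⊥} heavy 1+m≤S (≤-reflexive (cong (_+ suc m) (∣⊥∣≡0 (suc (2 * m))))))

  sharedNeighbour⇒matching : ∀ {S x y b} → HeavySet c S → m ≤ ∣ S ∣ → x ∈ S → y ∉ S
    → χ x b ≡ c → χ y b ≡ c → MonoConnMatching χ (suc m)
  sharedNeighbour⇒matching {c} {S} {x} {y} {b} heavy m≤S x∈S y∉S xb yb = record
    { colour = c ; L = y Vector.∷ L ; R = b Vector.∷ R
    ; L-inj = injective-∷ L-inj λ i eq → y∉S (subst (_∈ S) eq (L∈S i))
    ; R-inj = injective-∷ R-inj λ i eq → R∉F i (subst (_∈ ⁅ b ⁆) (sym eq) (x∈⁅x⁆ b))
    ; mono = λ { zero → yb ; (suc i) → mono i }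
    ; conn = λ i j → Connected-trans (toX i) (Connected-sym (toX j)) }
    where
    open Matching (heavyMatching {F = ⁅ b ⁆} heavy m≤S (≤-reflexive (cong (_+ m) (∣⁅x⁆∣≡1 b))))
    toX : ∀ i → Connected χ c (inj₁ ((y Vector.∷ L) i)) (inj₁ x)
    toX zero    = commonNeighbour⇒Connected yb xb
    toX (suc i) = heavy⇒Connected (heavy (L∈S i)) (heavy x∈S)

  Crossing : Set
  Crossing = ∃[ x ] ∃[ y ] ∃[ b ] x ∈ H × y ∉ H × χ x b ≡ χ y b

  crossing? : Dec Crossing
  crossing? = any? λ x → any? λ y → any? λ b → (x ∈? H) ×-dec ¬? (y ∈? H) ×-dec (χ x b ≟ᶜ χ y b)

  crossing⇒matching : Halves H → Crossing → MonoConnMatching χ (suc m)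
  crossing⇒matching (∣H∣≡m , ∣∁H∣≡m) (x , y , b , x∈H , y∉H , same) with χ x b in xb
  ... | red  = sharedNeighbour⇒matching H-heavy (≤-reflexive (sym ∣H∣≡m)) x∈H y∉H xb (sym same)
  ... | blue = sharedNeighbour⇒matching ∁H-heavy (≤-reflexive (sym ∣∁H∣≡m))
                 (x∉p⇒x∈∁p y∉H) (x∈p⇒x∉∁p x∈H) (sym same) xb

  noCrossing⇒structured : m ≥ 1 → Halves H → ¬ Crossing → Structured m χ
  noCrossing⇒structured m≥1 (∣H∣≡m , ∣∁H∣≡m) noCrossing
    with 0<∣p∣⇒Nonempty H (≤-trans m≥1 (≤-reflexive (sym ∣H∣≡m)))
       | 0<∣p∣⇒Nonempty (∁ H) (≤-trans m≥1 (≤-reflexive (sym ∣∁H∣≡m)))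
  ... | x₀ , x₀∈H | y₀ , y₀∈∁H =
    H , Z , ∣H∣≡m , ∣∁H∣≡m
    , (λ x b x∈H b∈Z → trans (like-x₀ x∈H) (∈neighbourhood⁻ b∈Z))
    , (λ y b y∈∁H b∈∁Z → two-colours (λ yb → unlike-x₀ y∈∁H (trans yb (sym (x₀-blue b∈∁Z)))) λ ())
    , (λ x b x∈H b∈∁Z → trans (like-x₀ x∈H) (x₀-blue b∈∁Z))
    , (λ y b y∈∁H b∈Z → two-colours (λ yb → unlike-x₀ y∈∁H (trans yb (sym (∈neighbourhood⁻ b∈Z)))) λ ())
    where
    Z = neighbourhood χ red x₀
    differ : ∀ {x y b} → x ∈ H → y ∈ ∁ H → χ x b ≢ χ y b
    differ x∈H y∈∁H same = noCrossing (_ , _ , _ , x∈H , x∈∁p⇒x∉p y∈∁H , same)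
    like-x₀ : ∀ {x b} → x ∈ H → χ x b ≡ χ x₀ b
    like-x₀ x∈H = two-colours (differ x∈H y₀∈∁H) (differ x₀∈H y₀∈∁H)
    unlike-x₀ : ∀ {y b} → y ∈ ∁ H → χ y b ≢ χ x₀ b
    unlike-x₀ y∈∁H = differ x₀∈H y∈∁H ∘ sym
    x₀-blue : ∀ {b} → b ∈ ∁ Z → χ x₀ b ≡ blue
    x₀-blue b∈∁Z = two-colours (x∈∁p⇒x∉p b∈∁Z ∘ ∈neighbourhood⁺) λ ()

  matching⊎structured : m ≥ 1 → MonoConnMatching χ (suc m) ⊎ Structured m χ
  matching⊎structured m≥1 with suc m ≤? ∣ H ∣ | suc m ≤? ∣ ∁ H ∣
  ... | yes large | _         = inj₁ (largeHeavySet⇒matching H-heavy large)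
  ... | no _      | yes large = inj₁ (largeHeavySet⇒matching ∁H-heavy large)
  ... | no small  | no small′ with halves H (≤-pred (≰⇒> small)) (≤-pred (≰⇒> small′)) | crossing?
  ...   | sizes | yes crossing  = inj₁ (crossing⇒matching sizes crossing)
  ...   | sizes | no noCrossing = inj₂ (noCrossing⇒structured m≥1 sizes noCrossing)

lemma5p2 : (m : ℕ) → m ≥ 1 → (χ : Colouring (2 * m) (suc (2 * m)))
    → MonoConnMatching χ (suc m) ⊎ Structured m χ
lemma5p2 m m≥1 χ = Bipartite.matching⊎structured m χ m≥1
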